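{- The set $\{11\}\subseteq\mathbb{YF}$ is first-order definable in $\mathbf{YF}^*=\langle\mathbb{YF},\geqslant,2\rangle$.
   Context: $\mathbb{YF}$ is the set of all finite words (including the empty word $\varepsilon$) over $\{1,2\}$. For a word $v$, $\#v$ is its length and $d(v)$ the number of letters $2$. Order: write $x=x'w$, $y=y'w$ with $w$ the longest common suffix; then $y\geqslant x$ iff $d(y')\geqslant\#x'$. $\mathbf{YF}^*$ is this partial order with an added constant symbol interpreted as the word $2$. A set is first-order definable if there is a first-order formula in the language $\{\geqslant,2\}$ whose set of satisfying elements is exactly that set. -}

module Defs where

open import Data.Nat using (ℕ; zero; suc; _≥_)
open import Data.Fin using (Fin)
open import Data.List using (List; []; _∷_; length; reverse)
open import Data.Vec using (Vec; lookup) renaming (_∷_ to _∷ᵥ_)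
open import Data.Product using (_×_; _,_; Σ; proj₁; proj₂)
open import Data.Sum using (_⊎_)
open import Relation.Nullary using (¬_)
open import Relation.Binary.PropositionalEquality using (_≡_)

data Letter : Set where
  one two : Letter

Word : Set
Word = List Letter

d : Word → ℕ
d [] = 0
d (one ∷ w) = d w
d (two ∷ w) = suc (d w)

stripPrefix : Word → Word → Word × Word
stripPrefix (one ∷ as) (one ∷ bs) = stripPrefix as bs
stripPrefix (two ∷ as) (two ∷ bs) = stripPrefix as bs
stripPrefix as bs = as , bs

-- x = x' w, y = y' w with w the longest common suffix.
splitSuffix : Word → Word → Word × Word
splitSuffix x y with stripPrefix (reverse x) (reverse y)
... | (rx , ry) = reverse rx , reverse ry

_⊒_ : Word → Word → Set
y ⊒ x = d (proj₂ (splitSuffix x y)) ≥ length (proj₁ (splitSuffix x y))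

word2 : Word
word2 = two ∷ []

word11 : Word
word11 = one ∷ one ∷ []

data Term (n : ℕ) : Set where
  var : Fin n → Term n
  c2  : Term n

data Formula : ℕ → Set where
  _≥'_ : ∀ {n} → Term n → Term n → Formula n
  _≈'_ : ∀ {n} → Term n → Term n → Formula n
  ⊥'   : ∀ {n} → Formula n
  ¬'_  : ∀ {n} → Formula n → Formula n
  _∧'_ : ∀ {n} → Formula n → Formula n → Formula n
  _∨'_ : ∀ {n} → Formula n → Formula n → Formula n
  _⇒'_ : ∀ {n} → Formula n → Formula n → Formula n
  ∀'_  : ∀ {n} → Formula (suc n) → Formula n
  ∃'_  : ∀ {n} → Formula (suc n) → Formula n

⟦_⟧ₜ : ∀ {n} → Term n → Vec Word n → Word
⟦ var i ⟧ₜ ρ = lookup ρ i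
⟦ c2 ⟧ₜ ρ = word2

-- satisfaction in YF* = ⟨𝕐𝔽, ≥, 2⟩ (variable 0 is the most recently bound)
Sat : ∀ {n} → Formula n → Vec Word n → Set
Sat (s ≥' t) ρ = ⟦ s ⟧ₜ ρ ⊒ ⟦ t ⟧ₜ ρ
Sat (s ≈' t) ρ = ⟦ s ⟧ₜ ρ ≡ ⟦ t ⟧ₜ ρ
Sat ⊥' ρ = Data.Empty.⊥
  where import Data.Empty
Sat (¬' φ) ρ = ¬ Sat φ ρ
Sat (φ ∧' ψ) ρ = Sat φ ρ × Sat ψ ρ
Sat (φ ∨' ψ) ρ = Sat φ ρ ⊎ Sat ψ ρ
Sat (φ ⇒' ψ) ρ = Sat φ ρ → Sat ψ ρ
Sat (∀' φ) ρ = (w : Word) → Sat φ (w ∷ᵥ ρ)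
Sat (∃' φ) ρ = Σ Word λ w → Sat φ (w ∷ᵥ ρ)

Definable : (Word → Set) → Set
Definable S = Σ (Formula 1) λ φ → (v : Word) → (Sat φ (v ∷ᵥ Data.Vec.[]) → S v) × (S v → Sat φ (v ∷ᵥ Data.Vec.[]))
  where import Data.Vec

-- 11 is the only word that is not below 2 and all of whose other lower bounds lie strictly
-- below 2, and this property is first-order.  Since y ≥ x forces #x ≤ #y, the words below 11
-- are ε, 1, 11, all but 11 strictly below 2.  Conversely, a word not below 2 and other than 11
-- lies above 2 if it contains a letter 2, and above its suffix 11 otherwise.
module Submission where

open import Defs
open import Relation.Binary.PropositionalEquality
  using (_≡_; _≢_; refl; sym; trans; cong; subst)
open import Data.Nat using (zero; suc; _+_; _≤_; z≤n; s≤s)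
open import Data.Nat.Properties using (+-monoʳ-≤; m≤n⇒m≤1+n; module ≤-Reasoning)
open import Data.Fin using (zero; suc)
open import Data.List using ([]; _∷_; _++_; _∷ʳ_; length; reverse)
open import Data.List.Properties using (length-++; length-reverse; reverse-involutive; reverse-++)
open import Data.List.Reverse using (reverseView; []; _∶_∶ʳ_)
open import Data.Product using (_×_; _,_; Σ-syntax; proj₁; proj₂)
open import Data.Sum using (_⊎_; inj₁; inj₂)
open import Data.Empty using (⊥-elim)
open import Relation.Nullary using (¬_)
open import Function.Bundles using (_⇔_; mk⇔; Equivalence)

stripPrefix-++ : ∀ as bs →
  Σ[ c ∈ Word ] as ≡ c ++ proj₁ (stripPrefix as bs) × bs ≡ c ++ proj₂ (stripPrefix as bs)
stripPrefix-++ (one ∷ as) (one ∷ bs) with c , as≡ , bs≡ ← stripPrefix-++ as bs =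
  one ∷ c , cong (one ∷_) as≡ , cong (one ∷_) bs≡
stripPrefix-++ (two ∷ as) (two ∷ bs) with c , as≡ , bs≡ ← stripPrefix-++ as bs =
  two ∷ c , cong (two ∷_) as≡ , cong (two ∷_) bs≡
stripPrefix-++ []         _          = [] , refl , refl
stripPrefix-++ (one ∷ _)  []         = [] , refl , refl
stripPrefix-++ (one ∷ _)  (two ∷ _)  = [] , refl , refl
stripPrefix-++ (two ∷ _)  []         = [] , refl , refl
stripPrefix-++ (two ∷ _)  (one ∷ _)  = [] , refl , refl

stripPrefix-++-self : ∀ as bs → stripPrefix as (as ++ bs) ≡ ([] , bs)
stripPrefix-++-self []         []         = refl
stripPrefix-++-self []         (one ∷ _)  = refl
stripPrefix-++-self []         (two ∷ _)  = refl
stripPrefix-++-self (one ∷ as) bs         = stripPrefix-++-self as bs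
stripPrefix-++-self (two ∷ as) bs         = stripPrefix-++-self as bs

d≤length : ∀ w → d w ≤ length w
d≤length []        = z≤n
d≤length (one ∷ w) = m≤n⇒m≤1+n (d≤length w)
d≤length (two ∷ w) = s≤s (d≤length w)

⊒-unfold : ∀ {x y a b} → stripPrefix (reverse x) (reverse y) ≡ (a , b) →
           y ⊒ x ⇔ length (reverse a) ≤ d (reverse b)
⊒-unfold {x} {y} eq with stripPrefix (reverse x) (reverse y)
⊒-unfold refl | _ = mk⇔ (λ h → h) (λ h → h)

⊒⇒length≤ : ∀ {x y} → y ⊒ x → length x ≤ length y
⊒⇒length≤ {x} {y} y⊒x with stripPrefix-++ (reverse x) (reverse y)
... | c , x≡ , y≡ = begin
  length x            ≡⟨ length-reverse x ⟨
  length (reverse x)  ≡⟨ cong length x≡ ⟩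
  length (c ++ a)     ≡⟨ length-++ c ⟩
  length c + length a ≤⟨ +-monoʳ-≤ (length c) a≤b ⟩
  length c + length b ≡⟨ length-++ c ⟨
  length (c ++ b)     ≡⟨ cong length y≡ ⟨
  length (reverse y)  ≡⟨ length-reverse y ⟩
  length y            ∎
  where
  open ≤-Reasoning
  a = proj₁ (stripPrefix (reverse x) (reverse y))
  b = proj₂ (stripPrefix (reverse x) (reverse y))
  a≤b : length a ≤ length b
  a≤b = begin
    length a           ≡⟨ length-reverse a ⟨
    length (reverse a) ≤⟨ Equivalence.to (⊒-unfold {x} {y} refl) y⊒x ⟩
    d (reverse b)      ≤⟨ d≤length (reverse b) ⟩
    length (reverse b) ≡⟨ length-reverse b ⟩
    length b           ∎

++-⊒ : ∀ u w → (u ++ w) ⊒ w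
++-⊒ u w = Equivalence.from (⊒-unfold {w} {u ++ w} split) z≤n
  where
  split : stripPrefix (reverse w) (reverse (u ++ w)) ≡ ([] , reverse u)
  split = trans (cong (stripPrefix (reverse w)) (reverse-++ u w))
                (stripPrefix-++-self (reverse w) (reverse u))

1≤d⇒⊒word2 : ∀ v → 1 ≤ d v → v ⊒ word2
1≤d⇒⊒word2 v 1≤dv with reverseView v
1≤d⇒⊒word2 .[]             () | []
1≤d⇒⊒word2 .(xs ∷ʳ two) _     | xs ∶ _ ∶ʳ two = ++-⊒ xs word2
1≤d⇒⊒word2 .(xs ∷ʳ one) 1≤dv  | xs ∶ _ ∶ʳ one =
  Equivalence.from (⊒-unfold {word2} {xs ∷ʳ one} split)
    (subst (λ w → 1 ≤ d w) (sym (reverse-involutive (xs ∷ʳ one))) 1≤dv)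
  where
  split : stripPrefix word2 (reverse (xs ∷ʳ one)) ≡ (word2 , reverse (xs ∷ʳ one))
  split = subst (λ r → stripPrefix word2 r ≡ (word2 , r)) (sym (reverse-++ xs (one ∷ []))) refl

ones-slide : ∀ u → d u ≡ 0 → one ∷ one ∷ u ≡ u ++ word11
ones-slide []        _   = refl
ones-slide (one ∷ u) du  = cong (one ∷_) (ones-slide u du)
ones-slide (two ∷ u) ()

Word11Property : Word → Set
Word11Property v = ¬ word2 ⊒ v × (∀ z → v ⊒ z → z ≡ v ⊎ (word2 ⊒ z × z ≢ word2))

-- Sat isWord11 (v ∷ []) unfolds definitionally to Word11Property v.
isWord11 : Formula 1
isWord11 = (¬' (c2 ≥' var zero)) ∧'
           (∀' ((var (suc zero) ≥' var zero) ⇒'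
                ((var zero ≈' var (suc zero)) ∨' ((c2 ≥' var zero) ∧' (¬' (var zero ≈' c2))))))

word11-property : Word11Property word11
word11-property = (λ { (s≤s ()) }) , below
  where
  below : ∀ z → word11 ⊒ z → z ≡ word11 ⊎ (word2 ⊒ z × z ≢ word2)
  below []                 _ = inj₂ (z≤n , λ ())
  below (one ∷ [])         _ = inj₂ (s≤s z≤n , λ ())
  below (one ∷ one ∷ [])   _ = inj₁ refl
  below (two ∷ [])         ()
  below (one ∷ two ∷ [])   ()
  below (two ∷ one ∷ [])   ()
  below (two ∷ two ∷ [])   ()
  below z@(_ ∷ _ ∷ _ ∷ _)  11⊒z with ⊒⇒length≤ {z} {word11} 11⊒z
  ... | s≤s (s≤s ())

property⇒d≡0 : ∀ v → Word11Property v → d v ≡ 0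
property⇒d≡0 v (v⋣2 , below) with d v in dv
... | zero  = refl
... | suc _ with below word2 (1≤d⇒⊒word2 v (subst (1 ≤_) (sym dv) (s≤s z≤n)))
...   | inj₁ 2≡v        = ⊥-elim (v⋣2 (subst (word2 ⊒_) 2≡v z≤n))
...   | inj₂ (_ , 2≢2)  = ⊥-elim (2≢2 refl)

ones-property⇒≡word11 : ∀ v → d v ≡ 0 → Word11Property v → v ≡ word11
ones-property⇒≡word11 []               _  (v⋣2 , _) = ⊥-elim (v⋣2 z≤n)
ones-property⇒≡word11 (one ∷ [])       _  (v⋣2 , _) = ⊥-elim (v⋣2 (s≤s z≤n))
ones-property⇒≡word11 (one ∷ one ∷ []) _  _         = refl
ones-property⇒≡word11 (one ∷ one ∷ u@(_ ∷ _)) du (_ , below)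
  with below word11 (subst (_⊒ word11) (sym (ones-slide u du)) (++-⊒ u word11))
... | inj₂ (s≤s () , _)
ones-property⇒≡word11 (one ∷ two ∷ _)  () _
ones-property⇒≡word11 (two ∷ _)        () _

mainTheorem12 : Definable (λ v → v ≡ word11)
mainTheorem12 = isWord11 , λ v →
  (λ p → ones-property⇒≡word11 v (property⇒d≡0 v p) p) , λ { refl → word11-property }
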